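{- Let $\mathbf{v}=(5,10)$ and $\mathbf{k}=(2,2)$. Then $D(\mathbf{v},\mathbf{k},2)=10$.
   Context: Let $X_1,X_2$ be disjoint sets with $|X_1|=v_1$, $|X_2|=v_2$. A block is a pair $(B_1,B_2)$ with $B_1$ a $2$-subset of $X_1$ and $B_2$ a $2$-subset of $X_2$. A $2$-$((v_1,v_2),(2,2),1)$ generalized packing is a family of blocks such that each $2$-subset of $X_1$ occurs as $B_1$ in at most one block, each $2$-subset of $X_2$ occurs as $B_2$ in at most one block, and for each $a\in X_1$, $b\in X_2$ at most one block has $a\in B_1$ and $b\in B_2$. $D(\mathbf{v},\mathbf{k},2)$ is the maximum number of blocks in such a generalized packing. -}

module Defs where

open import Data.Nat using (ℕ; _≤_)
open import Data.Fin using (Fin; _<_)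
open import Data.List using (List; length; lookup)
open import Data.Product using (Σ; _×_; _,_; ∃)
open import Data.Sum using (_⊎_)
open import Relation.Binary.PropositionalEquality using (_≡_)

-- A 2-subset {x, y} of Fin n, represented canonically as an ordered pair x < y.
record TwoSubset (n : ℕ) : Set where
  constructor pair
  field
    fst : Fin n
    snd : Fin n
    fst<snd : fst < snd
open TwoSubset public

-- Same 2-subset (proof-irrelevant on the ordering witness).
_≈₂_ : ∀ {n} → TwoSubset n → TwoSubset n → Set
A ≈₂ B = (fst A ≡ fst B) × (snd A ≡ snd B)

_∈₂_ : ∀ {n} → Fin n → TwoSubset n → Set
x ∈₂ A = (x ≡ fst A) ⊎ (x ≡ snd A)

Block : ℕ → ℕ → Set
Block v₁ v₂ = TwoSubset v₁ × TwoSubset v₂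

B₁ : ∀ {v₁ v₂} → Block v₁ v₂ → TwoSubset v₁
B₁ (a , _) = a

B₂ : ∀ {v₁ v₂} → Block v₁ v₂ → TwoSubset v₂
B₂ (_ , b) = b

-- A family of blocks is a list (indexed family); the packing conditions
-- say that any two positions whose blocks share the relevant feature coincide.
record IsGenPacking {v₁ v₂ : ℕ} (F : List (Block v₁ v₂)) : Set where
  field
    pair₁-once : ∀ (p q : Fin (length F)) →
      B₁ (lookup F p) ≈₂ B₁ (lookup F q) → p ≡ q
    pair₂-once : ∀ (p q : Fin (length F)) →
      B₂ (lookup F p) ≈₂ B₂ (lookup F q) → p ≡ q
    cross-once : ∀ (a : Fin v₁) (b : Fin v₂) (p q : Fin (length F)) →
      a ∈₂ B₁ (lookup F p) → b ∈₂ B₂ (lookup F p) →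
      a ∈₂ B₁ (lookup F q) → b ∈₂ B₂ (lookup F q) → p ≡ q

-- D((v₁,v₂),(2,2),2) = m : m is the maximum size of such a generalized packing.
IsMaxPackingSize : ℕ → ℕ → ℕ → Set
IsMaxPackingSize v₁ v₂ m =
  (Σ (List (Block v₁ v₂)) λ F → IsGenPacking F × length F ≡ m)
  × (∀ (F : List (Block v₁ v₂)) → IsGenPacking F → length F ≤ m)

module Submission where

-- In a generalized packing the first components B₁ of the
-- blocks are pairwise distinct 2-subsets of X₁, so a packing has at most
-- as many blocks as X₁ has 2-subsets.  We make this counting argument
-- precise for every v₁: the 2-subsets of Fin n are enumerated injectively
-- by Fin (pairs n), where pairs n = n(n-1)/2 is given by the recursion
-- pairs (1 + n) = n + pairs n (split by whether the subset contains 0).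
-- For v₁ = 5 this gives the bound pairs 5 = 10.
--
-- The packing conditions only quantify over finite sets, so
-- being a generalized packing is decidable for every finite family; an
-- explicit family of 10 blocks, using each 2-subset of X₁ once, is then
-- certified to be a packing by evaluating that decision procedure.

open import Defs
open import Data.Nat as ℕ using (ℕ; zero; suc; _+_; _≤_; s≤s)
open import Data.Fin using (Fin; zero; suc; #_; _↑ˡ_; _↑ʳ_; splitAt; _≟_; _<?_)
open import Data.Fin.Properties using (all?; injective⇒≤; ↑ˡ-injective; ↑ʳ-injective; splitAt-↑ˡ; splitAt-↑ʳ)
open import Data.List using (List; []; _∷_; length; lookup)
open import Data.Product using (_,_)
open import Relation.Nullary using (Dec; ¬_)
open import Relation.Nullary.Decidable using (True; toWitness; map′; _×-dec_; _⊎-dec_; _→-dec_)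
open import Relation.Binary using (Decidable)
open import Relation.Binary.PropositionalEquality using (_≡_; refl; cong; trans; sym)

pairs : ℕ → ℕ
pairs zero    = 0
pairs (suc n) = n + pairs n

-- An enumeration of the 2-subsets of Fin n: the subsets {0, j+1} come
-- first (n of them), followed by the 2-subsets of the remaining n points.
pairIndex : ∀ {n} → TwoSubset n → Fin (pairs n)
pairIndex {suc n} (pair zero    (suc j) _)         = j ↑ˡ pairs n
pairIndex {suc n} (pair (suc i) (suc j) (s≤s i<j)) = n ↑ʳ pairIndex (pair i j i<j)

↑ˡ≢↑ʳ : ∀ {m n} (i : Fin m) (j : Fin n) → ¬ (i ↑ˡ n ≡ m ↑ʳ j)
↑ˡ≢↑ʳ {m} {n} i j eq with trans (sym (splitAt-↑ˡ m i n)) (trans (cong (splitAt m) eq) (splitAt-↑ʳ m n j))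
... | ()

pairIndex-injective : ∀ {n} (A B : TwoSubset n) → pairIndex A ≡ pairIndex B → A ≈₂ B
pairIndex-injective {suc n} (pair zero (suc j) _) (pair zero (suc j′) _) eq =
  refl , cong suc (↑ˡ-injective (pairs n) j j′ eq)
pairIndex-injective {suc n} (pair zero (suc j) _) (pair (suc i′) (suc j′) (s≤s _)) eq
  with ↑ˡ≢↑ʳ j _ eq
... | ()
pairIndex-injective {suc n} (pair (suc i) (suc j) (s≤s _)) (pair zero (suc j′) _) eq
  with ↑ˡ≢↑ʳ j′ _ (sym eq)
... | ()
pairIndex-injective {suc n} (pair (suc i) (suc j) (s≤s i<j)) (pair (suc i′) (suc j′) (s≤s i′<j′)) eq
  with pairIndex-injective (pair i j i<j) (pair i′ j′ i′<j′) (↑ʳ-injective n _ _ eq)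
... | i≡i′ , j≡j′ = cong suc i≡i′ , cong suc j≡j′

packing-size-bound : ∀ {v₁ v₂} (F : List (Block v₁ v₂)) → IsGenPacking F → length F ≤ pairs v₁
packing-size-bound F P = injective⇒≤ {f = λ p → pairIndex (B₁ (lookup F p))}
  λ {p} {q} eq → IsGenPacking.pair₁-once P p q (pairIndex-injective _ _ eq)

_≈₂?_ : ∀ {n} → Decidable (_≈₂_ {n})
A ≈₂? B = (fst A ≟ fst B) ×-dec (snd A ≟ snd B)

_∈₂?_ : ∀ {n} → Decidable (_∈₂_ {n})
x ∈₂? A = (x ≟ fst A) ⊎-dec (x ≟ snd A)

isGenPacking? : ∀ {v₁ v₂} (F : List (Block v₁ v₂)) → Dec (IsGenPacking F)
isGenPacking? {v₁} {v₂} F =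
  map′ (λ (p₁ , p₂ , c) → record { pair₁-once = p₁ ; pair₂-once = p₂ ; cross-once = c })
       (λ P → IsGenPacking.pair₁-once P , IsGenPacking.pair₂-once P , IsGenPacking.cross-once P)
       (pair₁? ×-dec pair₂? ×-dec cross?)
  where
  Index : Set
  Index = Fin (length F)

  block : Index → Block v₁ v₂
  block = lookup F

  pair₁? : Dec (∀ (p q : Index) → B₁ (block p) ≈₂ B₁ (block q) → p ≡ q)
  pair₁? = all? λ p → all? λ q → (B₁ (block p) ≈₂? B₁ (block q)) →-dec (p ≟ q)

  pair₂? : Dec (∀ (p q : Index) → B₂ (block p) ≈₂ B₂ (block q) → p ≡ q)
  pair₂? = all? λ p → all? λ q → (B₂ (block p) ≈₂? B₂ (block q)) →-dec (p ≟ q)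

  cross? : Dec (∀ (a : Fin v₁) (b : Fin v₂) (p q : Index) →
                  a ∈₂ B₁ (block p) → b ∈₂ B₂ (block p) →
                  a ∈₂ B₁ (block q) → b ∈₂ B₂ (block q) → p ≡ q)
  cross? = all? λ a → all? λ b → all? λ p → all? λ q →
    (a ∈₂? B₁ (block p)) →-dec ((b ∈₂? B₂ (block p)) →-dec
    ((a ∈₂? B₁ (block q)) →-dec ((b ∈₂? B₂ (block q)) →-dec (p ≟ q))))

-- The 2-subset {i, j} of Fin n, given by numerals i < j < n; both
-- inequalities are checked by evaluation.
⟨_,_⟩ : ∀ {n} (i j : ℕ) {i<n : True (i ℕ.<? n)} {j<n : True (j ℕ.<? n)}
        {i<j : True ((# i) {m<n = i<n} <? (# j) {m<n = j<n})} → TwoSubset n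
⟨ i , j ⟩ {i<n} {j<n} {i<j} = pair ((# i) {m<n = i<n}) ((# j) {m<n = j<n}) (toWitness i<j)

optimalPacking : List (Block 5 10)
optimalPacking =
  (⟨ 0 , 1 ⟩ , ⟨ 0 , 1 ⟩) ∷ (⟨ 0 , 2 ⟩ , ⟨ 2 , 3 ⟩) ∷ (⟨ 0 , 3 ⟩ , ⟨ 4 , 5 ⟩) ∷
  (⟨ 0 , 4 ⟩ , ⟨ 6 , 7 ⟩) ∷ (⟨ 1 , 2 ⟩ , ⟨ 4 , 6 ⟩) ∷ (⟨ 1 , 3 ⟩ , ⟨ 2 , 8 ⟩) ∷
  (⟨ 1 , 4 ⟩ , ⟨ 5 , 9 ⟩) ∷ (⟨ 2 , 3 ⟩ , ⟨ 7 , 9 ⟩) ∷ (⟨ 2 , 4 ⟩ , ⟨ 0 , 8 ⟩) ∷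
  (⟨ 3 , 4 ⟩ , ⟨ 1 , 3 ⟩) ∷ []

optimalPacking-isGenPacking : IsGenPacking optimalPacking
optimalPacking-isGenPacking = toWitness {a? = isGenPacking? optimalPacking} _

lemma5p37 : IsMaxPackingSize 5 10 10
lemma5p37 = (optimalPacking , optimalPacking-isGenPacking , refl) , packing-size-bound
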